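{- Let $n\ge1$ and $V_n=\{1,\dots,n\}$. (i) Let $V_n=W_1\cup W_2$ be a partition of $V_n$ into two nonempty sets. For $i=1,2$ let $X_i\subseteq\{(p,q)\mid p,q\in W_i,\ p\ne q\}$ be a face of ${\cal H}(B(n))$ and let $a_i\in W_i$. Let $Y\subseteq W_2\times W_1$ and $$X=X_1\cup X_2\cup\{(a_1,a_2)\}\cup Y.$$ Then $X$ is a face of ${\cal H}(B(n))$. (ii) Every nonempty face of ${\cal H}(B(n))$ containing no idempotents can be obtained as in (i), for a suitable partition $V_n=W_1\cup W_2$ into two nonempty sets, faces $X_1,X_2$, elements $a_1,a_2$ and set $Y$ as in (i).
   Context: For $n\ge1$, $B(n)$ denotes the aperiodic Brandt semigroup: the set $(\{1,\dots,n\}\times\{1,\dots,n\})\cup\{0\}$, where $0$ is a zero element and $(i,j)(k,l)=(i,l)$ if $j=k$ and $(i,j)(k,l)=0$ otherwise. Its idempotents are $0$ and the $(i,i)$. For $Y\subseteq B(n)$, $Y^+$ denotes the subsemigroup generated by $Y$ ($\emptyset^+=\emptyset$). The subsemigroup complex ${\cal H}(B(n))$ has vertex set $B(n)$, and a subset $X$ is a face iff it admits an enumeration $x_1,\dots,x_k$ with $\emptyset\subset\{x_1\}^+\subset\{x_1,x_2\}^+\subset\cdots\subset\{x_1,\dots,x_k\}^+$ (all inclusions strict). -}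

module Defs where

open import Data.Nat using (ℕ; suc; _≤_)
open import Data.Fin using (Fin; toℕ; _≟_)
open import Data.Fin.Subset as S using (Subset; ∁; Nonempty)
open import Data.List using (List; []; _∷_; _++_; take; length)
open import Data.List.Membership.Propositional using (_∈_)
open import Data.List.Relation.Unary.All using (All)
open import Data.List.Relation.Unary.Unique.Propositional using (Unique)
open import Data.Product using (Σ; ∃; ∃-syntax; _×_; _,_)
open import Relation.Nullary using (¬_; yes; no)
open import Relation.Binary.PropositionalEquality using (_≡_; _≢_)
open import Function.Bundles using (_⇔_)

-- The aperiodic Brandt semigroup B(n): elements 0 and (i,j), i,j ∈ {1..n}
-- (encoded by Fin n).
data B (n : ℕ) : Set where
  𝟎    : B n
  ⟨_,_⟩ : Fin n → Fin n → B n

infixl 7 _·_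
_·_ : ∀ {n} → B n → B n → B n
𝟎 · _ = 𝟎
⟨ _ , _ ⟩ · 𝟎 = 𝟎
⟨ i , j ⟩ · ⟨ k , l ⟩ with j ≟ k
... | yes _ = ⟨ i , l ⟩
... | no  _ = 𝟎

Idempotent : ∀ {n} → B n → Set
Idempotent x = x · x ≡ x

data Gen {n : ℕ} (Y : List (B n)) : B n → Set where
  gen : ∀ {y} → y ∈ Y → Gen Y y
  mul : ∀ {a b} → Gen Y a → Gen Y b → Gen Y (a · b)

_⊂_ : ∀ {n} → (B n → Set) → (B n → Set) → Set
P ⊂ Q = (∀ {z} → P z → Q z) × ∃[ z ] (Q z × ¬ P z)

StrictChain : ∀ {n} → List (B n) → Set
StrictChain xs = (i : Fin (length xs)) →
  Gen (take (toℕ i) xs) ⊂ Gen (take (suc (toℕ i)) xs)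

-- Subsets of B(n) are given as lists (the set of their entries).
-- X is a face of H(B(n)) iff it admits an enumeration with strict chain.
IsFace : ∀ {n} → List (B n) → Set
IsFace {n} X = ∃[ xs ] (Unique xs × (∀ (x : B n) → (x ∈ xs ⇔ x ∈ X)) × StrictChain xs)

OffDiagIn : ∀ {n} → Subset n → B n → Set
OffDiagIn W x = ∃[ p ] ∃[ q ] (x ≡ ⟨ p , q ⟩ × p S.∈ W × q S.∈ W × p ≢ q)

PairIn : ∀ {n} → Subset n → Subset n → B n → Set
PairIn W W' x = ∃[ p ] ∃[ q ] (x ≡ ⟨ p , q ⟩ × p S.∈ W × q S.∈ W')

-- The data of construction (i): partition V_n = W ∪ ∁W (both nonempty),
-- W₁ = W, W₂ = ∁ W.
ConstrData : ∀ {n} → Subset n → List (B n) → List (B n) → Fin n → Fin n → List (B n) → Set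
ConstrData W X₁ X₂ a₁ a₂ Y =
  Nonempty W × Nonempty (∁ W) ×
  All (OffDiagIn W) X₁ × IsFace X₁ ×
  All (OffDiagIn (∁ W)) X₂ × IsFace X₂ ×
  a₁ S.∈ W × a₂ S.∈ ∁ W ×
  All (PairIn (∁ W) W) Y

Construct : ∀ {n} → List (B n) → List (B n) → Fin n → Fin n → List (B n) → List (B n)
Construct X₁ X₂ a₁ a₂ Y = X₁ ++ X₂ ++ (⟨ a₁ , a₂ ⟩ ∷ Y)

module Submission where

-- A non-zero element ⟨ p , q ⟩ of B(n) is read as an arrow p → q of a directed
-- graph on Fin n; then ⟨ p , q ⟩ lies in the subsemigroup generated by a set E
-- exactly when there is a walk from p to q along arrows of E.
--
-- (i)  List Y first (pairwise non-composable arrows ∁W → W), then X₁, X₂ and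
--      finally ⟨ a₁ , a₂ ⟩.  Each block stays irredundant: walks starting in W
--      never leave W, walks ending in ∁W never enter it from W, so the earlier
--      blocks never help, and a₂ ∉ W is unreachable from a₁ ∈ W.
-- (ii) Let ⟨ a , b ⟩ be the last entry of an irredundant enumeration and W the
--      set of vertices reachable from a along the earlier entries.  Then b ∉ W,
--      no earlier arrow leaves W, and the earlier entries split into the arrows
--      inside W, inside ∁W and from ∁W to W; sublists of irredundant lists are
--      irredundant, so the first two blocks are faces.

open import Defs
open import Data.Nat using (ℕ; _≤_)
open import Data.Fin using (Fin; zero; suc; toℕ) renaming (_≟_ to _≟F_)
open import Data.Fin.Subset using (Subset; ∁)
import Data.Fin.Subset as S
open import Data.Fin.Subset.Properties using (x∈∁p⇒x∉p; x∉p⇒x∈∁p) renaming (_∈?_ to _∈S?_)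
open import Data.Vec using (tabulate)
open import Data.Vec.Properties using (lookup⇒[]=; []=⇒lookup; lookup∘tabulate)
open import Data.List
  using (List; []; _∷_; _++_; _∷ʳ_; take; lookup; length; filter; deduplicate; initLast; _∷ʳ′_)
open import Data.List.Properties using (++-assoc; ++-identityʳ; take-suc)
open import Data.List.Membership.Propositional using (_∈_)
open import Data.List.Membership.Propositional.Properties
  using (∈-++⁺ˡ; ∈-++⁺ʳ; ∈-++⁻; ∈-filter⁺; ∈-filter⁻; deduplicate-∈⇔)
open import Data.List.Relation.Binary.Subset.Propositional using (_⊆_)
open import Data.List.Relation.Binary.Subset.Propositional.Properties
  using (⊆-refl) renaming (++⁺ to ⊆-++⁺)
open import Data.List.Relation.Binary.BagAndSetEquality using (_∼[_]_; set; commutativeMonoid)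
open import Data.List.Relation.Unary.Any using (here; there)
open import Data.List.Relation.Unary.All using (All; []; _∷_)
import Data.List.Relation.Unary.All as All
open import Data.List.Relation.Unary.All.Properties using (anti-mono; all-filter; filter⁺) renaming (++⁺ to all-++⁺)
open import Data.List.Relation.Unary.AllPairs using ([]; _∷_)
open import Data.List.Relation.Unary.Unique.Propositional using (Unique)
open import Data.List.Relation.Unary.Unique.DecPropositional.Properties using (deduplicate-!)
open import Data.Product using (∃-syntax; _×_; _,_; proj₁; proj₂; uncurry)
open import Data.Sum using (_⊎_; inj₁; inj₂; [_,_]′)
import Data.Sum as Sum
open import Data.Bool using (true; false)
open import Data.Empty using (⊥)
open import Relation.Nullary using (¬_; Dec; yes; no; does; contradiction)
open import Relation.Nullary.Decidable using (_×-dec_; _⊎-dec_; map′; dec-true)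
open import Relation.Unary using (Decidable)
open import Relation.Binary.Definitions using (DecidableEquality)
open import Relation.Binary.PropositionalEquality using (_≡_; _≢_; refl; sym; trans; subst; cong)
open import Relation.Binary.Construct.Closure.Transitive
  using (TransClosure; [_]; _∷_) renaming (_++_ to _++ʷ_)
open import Algebra.Bundles using (CommutativeMonoid)
open import Function using (_∘_)
open import Function.Bundles using (_⇔_; mk⇔; Equivalence)

subsetOf : ∀ {m} {P : Fin m → Set} → Decidable P → Subset m
subsetOf P? = tabulate (λ v → does (P? v))

∈-subsetOf⁺ : ∀ {m} {P : Fin m → Set} (P? : Decidable P) {v} → P v → v S.∈ subsetOf P?
∈-subsetOf⁺ P? {v} pv = lookup⇒[]= v _ (trans (lookup∘tabulate _ v) (dec-true (P? v) pv))

∈-subsetOf⁻ : ∀ {m} {P : Fin m → Set} (P? : Decidable P) {v} → v S.∈ subsetOf P? → P v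
∈-subsetOf⁻ {P = P} P? {v} v∈ = decided (P? v) (trans (sym (lookup∘tabulate _ v)) ([]=⇒lookup v∈))
  where
  decided : (d : Dec (P v)) → does d ≡ true → P v
  decided (yes pv) _ = pv
  decided (no _)   ()

module SetEq {A : Set} = CommutativeMonoid (commutativeMonoid set A)

filter-cover : {A : Set} {P Q R : A → Set} (P? : Decidable P) (Q? : Decidable Q) (R? : Decidable R)
  {xs : List A} → (∀ {x} → x ∈ xs → P x ⊎ Q x ⊎ R x) →
  xs ∼[ set ] (filter P? xs ++ filter Q? xs ++ filter R? xs)
filter-cover {A} P? Q? R? {xs} cover = mk⇔ into (outof P? (outof Q? (proj₁ ∘ ∈-filter⁻ R?)))
  where
  into : ∀ {x} → x ∈ xs → x ∈ filter P? xs ++ filter Q? xs ++ filter R? xs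
  into m with cover m
  ... | inj₁ p        = ∈-++⁺ˡ (∈-filter⁺ P? m p)
  ... | inj₂ (inj₁ q) = ∈-++⁺ʳ (filter P? xs) (∈-++⁺ˡ (∈-filter⁺ Q? m q))
  ... | inj₂ (inj₂ r) = ∈-++⁺ʳ (filter P? xs) (∈-++⁺ʳ (filter Q? xs) (∈-filter⁺ R? m r))
  outof : ∀ {F : A → Set} (F? : Decidable F) {rest x} →
    (x ∈ rest → x ∈ xs) → x ∈ filter F? xs ++ rest → x ∈ xs
  outof F? inRest m with ∈-++⁻ (filter F? xs) m
  ... | inj₁ f = proj₁ (∈-filter⁻ F? f)
  ... | inj₂ r = inRest r

module _ {n : ℕ} where

  ·-compose : (p m q : Fin n) → ⟨ p , m ⟩ · ⟨ m , q ⟩ ≡ ⟨ p , q ⟩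
  ·-compose p m q with m ≟F m
  ... | yes _   = refl
  ... | no m≢m = contradiction refl m≢m

  ·-factor : (a b : B n) {p q : Fin n} → a · b ≡ ⟨ p , q ⟩ →
    ∃[ m ] (a ≡ ⟨ p , m ⟩ × b ≡ ⟨ m , q ⟩)
  ·-factor 𝟎 b ()
  ·-factor ⟨ i , j ⟩ 𝟎 ()
  ·-factor ⟨ i , j ⟩ ⟨ k , l ⟩ eq with j ≟F k
  ·-factor ⟨ i , j ⟩ ⟨ .j , l ⟩ refl | yes refl = j , refl , refl
  ·-factor ⟨ i , j ⟩ ⟨ k , l ⟩ ()   | no _

  non-idempotent⇒off-diagonal : {x : B n} → ¬ Idempotent x → ∃[ p ] ∃[ q ] (x ≡ ⟨ p , q ⟩ × p ≢ q)
  non-idempotent⇒off-diagonal {𝟎} h = contradiction refl h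
  non-idempotent⇒off-diagonal {⟨ p , q ⟩} h = p , q , refl , λ { refl → h (·-compose p p p) }

  _≟B_ : DecidableEquality (B n)
  𝟎 ≟B 𝟎 = yes refl
  𝟎 ≟B ⟨ _ , _ ⟩ = no λ ()
  ⟨ _ , _ ⟩ ≟B 𝟎 = no λ ()
  ⟨ p , q ⟩ ≟B ⟨ p′ , q′ ⟩ with p ≟F p′ | q ≟F q′
  ... | yes refl | yes refl = yes refl
  ... | no p≢p′  | _        = no λ { refl → p≢p′ refl }
  ... | _        | no q≢q′  = no λ { refl → q≢q′ refl }

  Arrow : List (B n) → Fin n → Fin n → Set
  Arrow E p q = ⟨ p , q ⟩ ∈ E

  Walk : List (B n) → Fin n → Fin n → Set
  Walk E = TransClosure (Arrow E)

  walk-map : {E E′ : List (B n)} → (∀ {u v} → Arrow E u v → Arrow E′ u v) →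
    ∀ {p q} → Walk E p q → Walk E′ p q
  walk-map f [ e ]   = [ f e ]
  walk-map f (e ∷ w) = f e ∷ walk-map f w

  walk⇒gen : ∀ {E : List (B n)} {p q} → Walk E p q → Gen E ⟨ p , q ⟩
  walk⇒gen [ e ] = gen e
  walk⇒gen {E} (_∷_ {p} {m} {q} e w) = subst (Gen E) (·-compose p m q) (mul (gen e) (walk⇒gen w))

  gen⇒walk : ∀ {E : List (B n)} {z p q} → Gen E z → z ≡ ⟨ p , q ⟩ → Walk E p q
  gen⇒walk (gen e) refl = [ e ]
  gen⇒walk (mul {a} {b} g h) eq with ·-factor a b eq
  ... | m , refl , refl = gen⇒walk g refl ++ʷ gen⇒walk h refl

  gen-closed : ∀ {E E′ : List (B n)} {z} → (∀ {y} → y ∈ E → Gen E′ y) → Gen E z → Gen E′ z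
  gen-closed s (gen e)   = s e
  gen-closed s (mul g h) = mul (gen-closed s g) (gen-closed s h)

  gen-mono : ∀ {E E′ : List (B n)} {z} → E ⊆ E′ → Gen E z → Gen E′ z
  gen-mono s = gen-closed (gen ∘ s)

  -- Reachability (walks of length ≥ 0) and its decidability, by induction on
  -- the list of arrows: a walk using a new arrow s → t either avoids it or
  -- reaches s and continues from t.
  Reach : List (B n) → Fin n → Fin n → Set
  Reach E p q = p ≡ q ⊎ Walk E p q

  _◂_ : ∀ {E : List (B n)} {p m q} → Reach E p m → Walk E m q → Walk E p q
  inj₁ refl ◂ w = w
  inj₂ v    ◂ w = v ++ʷ w

  _▸_ : ∀ {E : List (B n)} {p m q} → Walk E p m → Reach E m q → Walk E p q
  w ▸ inj₁ refl = w
  w ▸ inj₂ v    = w ++ʷ v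

  walk-cons⁻ : ∀ {E : List (B n)} {s t p q} →
    Walk (⟨ s , t ⟩ ∷ E) p q → Walk E p q ⊎ (Reach E p s × Reach E t q)
  walk-cons⁻ [ here refl ] = inj₂ (inj₁ refl , inj₁ refl)
  walk-cons⁻ [ there e ]   = inj₁ [ e ]
  walk-cons⁻ (here refl ∷ w) with walk-cons⁻ w
  ... | inj₁ w′       = inj₂ (inj₁ refl , inj₂ w′)
  ... | inj₂ (_ , tq) = inj₂ (inj₁ refl , tq)
  walk-cons⁻ (there e ∷ w) with walk-cons⁻ w
  ... | inj₁ w′               = inj₁ (e ∷ w′)
  ... | inj₂ (inj₁ refl , tq) = inj₂ (inj₂ [ e ] , tq)
  ... | inj₂ (inj₂ ws , tq)   = inj₂ (inj₂ (e ∷ ws) , tq)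

  walk-cons⁺ : ∀ {E : List (B n)} {s t p q} →
    Walk E p q ⊎ (Reach E p s × Reach E t q) → Walk (⟨ s , t ⟩ ∷ E) p q
  walk-cons⁺ (inj₁ w)         = walk-map there w
  walk-cons⁺ (inj₂ (ps , tq)) = lift ps ◂ ([ here refl ] ▸ lift tq)
    where
    lift : ∀ {E : List (B n)} {x u v} → Reach E u v → Reach (x ∷ E) u v
    lift = Sum.map₂ (walk-map there)

  walk? : ∀ E p q → Dec (Walk E p q)
  reach? : ∀ E p q → Dec (Reach E p q)
  walk? [] p q = no λ { [ () ] ; (() ∷ _) }
  walk? (𝟎 ∷ E) p q = map′ (walk-map there) (walk-map λ { (here ()) ; (there e) → e }) (walk? E p q)
  walk? (⟨ s , t ⟩ ∷ E) p q = map′ walk-cons⁺ walk-cons⁻ (walk? E p q ⊎-dec (reach? E p s ×-dec reach? E t q))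
  reach? E p q = (p ≟F q) ⊎-dec walk? E p q

  walk-forward : ∀ {E E₀ : List (B n)} (S : Fin n → Set) →
    (∀ {u v} → Arrow E u v → S u → Arrow E₀ u v × S v) →
    ∀ {p q} → S p → Walk E p q → Walk E₀ p q × S q
  walk-forward S step sp [ e ] = let (e₀ , sq) = step e sp in [ e₀ ] , sq
  walk-forward S step sp (e ∷ w) =
    let (e₀ , sm) = step e sp ; (w₀ , sq) = walk-forward S step sm w in e₀ ∷ w₀ , sq

  walk-backward : ∀ {E E₀ : List (B n)} (S : Fin n → Set) →
    (∀ {u v} → Arrow E u v → S v → Arrow E₀ u v × S u) →
    ∀ {p q} → S q → Walk E p q → Walk E₀ p q × S p
  walk-backward S step sq [ e ] = let (e₀ , sp) = step e sq in [ e₀ ] , sp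
  walk-backward S step sq (e ∷ w) =
    let (w₀ , sm) = walk-backward S step sq w ; (e₀ , sp) = step e sm in e₀ ∷ w₀ , sp

  Arc : Subset n → Subset n → B n → Set
  Arc S T 𝟎         = ⊥
  Arc S T ⟨ p , q ⟩ = p S.∈ S × q S.∈ T

  arc? : (S T : Subset n) → Decidable (Arc S T)
  arc? S T 𝟎         = no λ ()
  arc? S T ⟨ p , q ⟩ = (p ∈S? S) ×-dec (q ∈S? T)

  arc-ends : ∀ {S T} {E : List (B n)} {p q} → All (Arc S T) E → Arrow E p q → p S.∈ S × q S.∈ T
  arc-ends arcs e = All.lookup arcs e

  offDiag⇒arc : ∀ {W} {x : B n} → OffDiagIn W x → Arc W W x
  offDiag⇒arc (_ , _ , refl , p∈W , q∈W , _) = p∈W , q∈W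

  arc⇒offDiag : ∀ {W} {x : B n} → ¬ Idempotent x → Arc W W x → OffDiagIn W x
  arc⇒offDiag {x = 𝟎} _ ()
  arc⇒offDiag {x = ⟨ p , q ⟩} h (p∈W , q∈W) with non-idempotent⇒off-diagonal h
  ... | _ , _ , refl , p≢q = p , q , refl , p∈W , q∈W , p≢q

  pairIn⇒arc : ∀ {S T} {x : B n} → PairIn S T x → Arc S T x
  pairIn⇒arc (_ , _ , refl , p∈S , q∈T) = p∈S , q∈T

  arc⇒pairIn : ∀ {S T} {x : B n} → Arc S T x → PairIn S T x
  arc⇒pairIn {x = ⟨ p , q ⟩} (p∈S , q∈T) = p , q , refl , p∈S , q∈T

  -- Arcs from S to T with S ∩ T = ∅ never compose, so such a set generates
  -- no new arc.
  gen-arcs : ∀ {S T} {E : List (B n)} {x} → (∀ {v} → v S.∈ S → ¬ v S.∈ T) →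
    All (Arc S T) E → Arc S T x → Gen E x → x ∈ E
  gen-arcs {x = 𝟎} _ _ () _
  gen-arcs {E = E} {x = ⟨ _ , _ ⟩} disjoint arcs _ g = single (gen⇒walk g refl)
    where
    single : ∀ {u v} → Walk E u v → Arrow E u v
    single [ e ]          = e
    single (e ∷ [ e′ ])   = contradiction (proj₂ (arc-ends arcs e)) (disjoint (proj₁ (arc-ends arcs e′)))
    single (e ∷ (e′ ∷ _)) = contradiction (proj₂ (arc-ends arcs e)) (disjoint (proj₁ (arc-ends arcs e′)))

  data Irredundant (pre : List (B n)) : List (B n) → Set where
    []  : Irredundant pre []
    _∷_ : ∀ {x xs} → ¬ Gen pre x → Irredundant (pre ∷ʳ x) xs → Irredundant pre (x ∷ xs)

  irr-resp : ∀ {pre pre′ xs : List (B n)} → pre ≡ pre′ → Irredundant pre xs → Irredundant pre′ xs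
  irr-resp {xs = xs} = subst (λ L → Irredundant L xs)

  snoc-++ : (pre : List (B n)) (x : B n) (A : List (B n)) → (pre ∷ʳ x) ++ A ≡ pre ++ x ∷ A
  snoc-++ pre x A = ++-assoc pre (x ∷ []) A

  irr-++⁺ : ∀ {pre A C : List (B n)} → Irredundant pre A → Irredundant (pre ++ A) C → Irredundant pre (A ++ C)
  irr-++⁺ {pre} [] d = irr-resp (++-identityʳ pre) d
  irr-++⁺ {pre} (_∷_ {x} {A} g c) d = g ∷ irr-++⁺ c (irr-resp (sym (snoc-++ pre x A)) d)

  irr-++⁻ : ∀ {pre : List (B n)} A {C} → Irredundant pre (A ++ C) → Irredundant pre A × Irredundant (pre ++ A) C
  irr-++⁻ {pre} [] c = [] , irr-resp (sym (++-identityʳ pre)) c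
  irr-++⁻ {pre} (x ∷ A) (g ∷ c) =
    let (c₁ , c₂) = irr-++⁻ A c in g ∷ c₁ , irr-resp (snoc-++ pre x A) c₂

  irr-new : ∀ {pre xs : List (B n)} → Irredundant pre xs → All (λ y → ¬ Gen pre y) xs
  irr-new [] = []
  irr-new (g ∷ c) = g ∷ All.map (λ ng → ng ∘ gen-mono ∈-++⁺ˡ) (irr-new c)

  irr-unique : ∀ {pre xs : List (B n)} → Irredundant pre xs → Unique xs
  irr-unique [] = []
  irr-unique {pre} (_∷_ {x} g c) = All.map distinct (irr-new c) ∷ irr-unique c
    where
    distinct : ∀ {y} → ¬ Gen (pre ∷ʳ x) y → x ≢ y
    distinct ng refl = ng (gen (∈-++⁺ʳ pre (here refl)))

  irr-filter : ∀ {P : B n → Set} (P? : Decidable P) {pre pre′ xs : List (B n)} →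
    pre′ ⊆ pre → Irredundant pre xs → Irredundant pre′ (filter P? xs)
  irr-filter P? s [] = []
  irr-filter P? s (_∷_ {x} g c) with does (P? x)
  ... | true  = (g ∘ gen-mono s) ∷ irr-filter P? (⊆-++⁺ s ⊆-refl) c
  ... | false = irr-filter P? (∈-++⁺ˡ ∘ s) c

  irr-prefix : ∀ {P : B n → Set} (extra : List (B n)) →
    (∀ {acc x} → All P acc → P x → Gen (extra ++ acc) x → Gen acc x) →
    ∀ {xs} → All P xs → Irredundant [] xs → Irredundant extra xs
  irr-prefix {P} extra useless ps irr = irr-resp (++-identityʳ extra) (go [] ps irr)
    where
    go : ∀ {acc xs} → All P acc → All P xs → Irredundant acc xs → Irredundant (extra ++ acc) xs
    go pa [] [] = []
    go {acc} pa (px ∷ ps) (_∷_ {x} g c) =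
      (g ∘ useless pa px) ∷ irr-resp (sym (++-assoc extra acc (x ∷ []))) (go (all-++⁺ pa (px ∷ [])) ps c)

  strict-step⁺ : ∀ {T : List (B n)} {x} → ¬ Gen T x → Gen T ⊂ Gen (T ∷ʳ x)
  strict-step⁺ {T} {x} ng = gen-mono ∈-++⁺ˡ , x , gen (∈-++⁺ʳ T (here refl)) , ng

  strict-step⁻ : ∀ {T : List (B n)} {x} → Gen T ⊂ Gen (T ∷ʳ x) → ¬ Gen T x
  strict-step⁻ {T} {x} (_ , z , gz , ngz) gx = ngz (gen-closed generated gz)
    where
    generated : ∀ {y} → y ∈ T ∷ʳ x → Gen T y
    generated m with ∈-++⁻ T m
    ... | inj₁ t           = gen t
    ... | inj₂ (here refl) = gx

  irr⇒positions : ∀ {pre xs : List (B n)} → Irredundant pre xs →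
    (i : Fin (length xs)) → ¬ Gen (pre ++ take (toℕ i) xs) (lookup xs i)
  irr⇒positions {pre} (g ∷ c) zero = subst (λ L → ¬ Gen L _) (sym (++-identityʳ pre)) g
  irr⇒positions {pre} (_∷_ {x} {xs} g c) (suc i) =
    subst (λ L → ¬ Gen L (lookup xs i)) (snoc-++ pre x (take (toℕ i) xs)) (irr⇒positions c i)

  positions⇒irr : ∀ {pre : List (B n)} xs →
    (∀ i → ¬ Gen (pre ++ take (toℕ i) xs) (lookup xs i)) → Irredundant pre xs
  positions⇒irr [] _ = []
  positions⇒irr {pre} (x ∷ xs) h =
    subst (λ L → ¬ Gen L x) (++-identityʳ pre) (h zero) ∷
    positions⇒irr xs λ i →
      subst (λ L → ¬ Gen L (lookup xs i)) (sym (snoc-++ pre x (take (toℕ i) xs))) (h (suc i))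

  strictChain⇒irr : ∀ {xs : List (B n)} → StrictChain xs → Irredundant [] xs
  strictChain⇒irr {xs} sc = positions⇒irr xs λ i →
    strict-step⁻ (subst (λ L → Gen (take (toℕ i) xs) ⊂ Gen L) (take-suc xs i) (sc i))

  irr⇒strictChain : ∀ {xs : List (B n)} → Irredundant [] xs → StrictChain xs
  irr⇒strictChain {xs} irr i =
    subst (λ L → Gen (take (toℕ i) xs) ⊂ Gen L) (sym (take-suc xs i)) (strict-step⁺ (irr⇒positions irr i))

  face⇒irr : ∀ {X : List (B n)} → IsFace X → ∃[ xs ] (Irredundant [] xs × xs ∼[ set ] X)
  face⇒irr (xs , _ , same , sc) = xs , strictChain⇒irr sc , λ {x} → same x

  irr⇒face : ∀ {xs X : List (B n)} → Irredundant [] xs → xs ∼[ set ] X → IsFace X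
  irr⇒face {xs} irr same = xs , irr-unique irr , (λ x → same) , irr⇒strictChain irr

  -- Distinct arcs from S to T, where S ∩ T = ∅, form an irredundant list after
  -- any list pre of such arcs not containing them: they never compose.
  arcs-irredundant : ∀ {S T} → (∀ {v} → v S.∈ S → ¬ v S.∈ T) → {pre L : List (B n)} →
    All (Arc S T) pre → All (Arc S T) L → Unique L → All (λ y → ¬ y ∈ pre) L → Irredundant pre L
  arcs-irredundant disjoint _ [] [] [] = []
  arcs-irredundant disjoint {pre} arcsPre (ax ∷ arcsL) (x≢ ∷ unique) (x∉ ∷ ∉pre) =
    (x∉ ∘ gen-arcs disjoint arcsPre ax) ∷
    arcs-irredundant disjoint (all-++⁺ arcsPre (ax ∷ [])) arcsL unique (All.zipWith fresh (x≢ , ∉pre))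
    where
    fresh : ∀ {x y} → x ≢ y × ¬ y ∈ pre → ¬ y ∈ pre ∷ʳ x
    fresh (x≢y , y∉) m with ∈-++⁻ pre m
    ... | inj₁ y∈          = y∉ y∈
    ... | inj₂ (here refl) = x≢y refl

  module Construction (W : Subset n) {a₁ a₂ : Fin n} (a₁∈W : a₁ S.∈ W) (a₂∉W : a₂ S.∈ ∁ W)
    {xs₁ xs₂ Y : List (B n)}
    (arcs₁ : All (Arc W W) xs₁) (arcs₂ : All (Arc (∁ W) (∁ W)) xs₂) (arcsY : All (Arc (∁ W) W) Y)
    (irr₁ : Irredundant [] xs₁) (irr₂ : Irredundant [] xs₂) where

    Y′ : List (B n)
    Y′ = deduplicate _≟B_ Y

    arcsY′ : All (Arc (∁ W) W) Y′
    arcsY′ = anti-mono (Equivalence.from (deduplicate-∈⇔ _≟B_)) arcsY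

    irrY′ : Irredundant [] Y′
    irrY′ = arcs-irredundant x∈∁p⇒x∉p [] arcsY′ (deduplicate-! _≟B_ Y) (All.tabulate λ _ ())

    -- No arc of Y′ starts in W, so walks from W along Y′ ++ acc use acc only.
    irr₁′ : Irredundant Y′ xs₁
    irr₁′ = irr-prefix Y′ useless arcs₁ irr₁
      where
      useless : ∀ {acc x} → All (Arc W W) acc → Arc W W x → Gen (Y′ ++ acc) x → Gen acc x
      useless {x = 𝟎} _ ()
      useless {acc} {⟨ _ , _ ⟩} arcsAcc (p∈W , _) g =
        walk⇒gen (proj₁ (walk-forward (S._∈ W) stay p∈W (gen⇒walk g refl)))
        where
        stay : ∀ {u v} → Arrow (Y′ ++ acc) u v → u S.∈ W → Arrow acc u v × v S.∈ W
        stay e u∈W with ∈-++⁻ Y′ e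
        ... | inj₁ y = contradiction u∈W (x∈∁p⇒x∉p (proj₁ (arc-ends arcsY′ y)))
        ... | inj₂ a = a , proj₂ (arc-ends arcsAcc a)

    -- Arcs of Y′ and xs₁ end in W, so walks into ∁W along them and acc use acc only.
    irr₂′ : Irredundant (Y′ ++ xs₁) xs₂
    irr₂′ = irr-prefix (Y′ ++ xs₁) useless arcs₂ irr₂
      where
      useless : ∀ {acc x} → All (Arc (∁ W) (∁ W)) acc → Arc (∁ W) (∁ W) x →
        Gen ((Y′ ++ xs₁) ++ acc) x → Gen acc x
      useless {x = 𝟎} _ ()
      useless {acc} {⟨ _ , _ ⟩} arcsAcc (_ , q∉W) g =
        walk⇒gen (proj₁ (walk-backward (S._∈ ∁ W) stay q∉W (gen⇒walk g refl)))
        where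
        stay : ∀ {u v} → Arrow ((Y′ ++ xs₁) ++ acc) u v → v S.∈ ∁ W → Arrow acc u v × u S.∈ ∁ W
        stay e v∉W with ∈-++⁻ (Y′ ++ xs₁) e
        ... | inj₂ a = a , proj₁ (arc-ends arcsAcc a)
        ... | inj₁ e′ with ∈-++⁻ Y′ e′
        ...   | inj₁ y  = contradiction (proj₂ (arc-ends arcsY′ y)) (x∈∁p⇒x∉p v∉W)
        ...   | inj₂ x₁ = contradiction (proj₂ (arc-ends arcs₁ x₁)) (x∈∁p⇒x∉p v∉W)

    -- No arc listed so far leaves W, so a₂ ∉ W is unreachable from a₁ ∈ W.
    irrₑ : Irredundant ((Y′ ++ xs₁) ++ xs₂) (⟨ a₁ , a₂ ⟩ ∷ [])
    irrₑ = unreachable ∷ []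
      where
      E = (Y′ ++ xs₁) ++ xs₂
      stay : ∀ {u v} → Arrow E u v → u S.∈ W → Arrow E u v × v S.∈ W
      stay e u∈W with ∈-++⁻ (Y′ ++ xs₁) e
      ... | inj₂ x₂ = contradiction u∈W (x∈∁p⇒x∉p (proj₁ (arc-ends arcs₂ x₂)))
      ... | inj₁ e′ with ∈-++⁻ Y′ e′
      ...   | inj₁ y  = contradiction u∈W (x∈∁p⇒x∉p (proj₁ (arc-ends arcsY′ y)))
      ...   | inj₂ x₁ = e , proj₂ (arc-ends arcs₁ x₁)
      unreachable : ¬ Gen E ⟨ a₁ , a₂ ⟩
      unreachable g = x∈∁p⇒x∉p a₂∉W (proj₂ (walk-forward (S._∈ W) stay a₁∈W (gen⇒walk g refl)))

    enumeration : List (B n)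
    enumeration = Y′ ++ xs₁ ++ xs₂ ++ ⟨ a₁ , a₂ ⟩ ∷ []

    enumeration-irr : Irredundant [] enumeration
    enumeration-irr = irr-++⁺ irrY′ (irr-++⁺ irr₁′ (irr-++⁺ irr₂′ irrₑ))

    same-elements : ∀ {X₁ X₂} → xs₁ ∼[ set ] X₁ → xs₂ ∼[ set ] X₂ →
      enumeration ∼[ set ] Construct X₁ X₂ a₁ a₂ Y
    same-elements {X₁} {X₂} same₁ same₂ = begin
      Y′ ++ xs₁ ++ xs₂ ++ E       ≈⟨ SetEq.comm Y′ _ ⟩
      (xs₁ ++ xs₂ ++ E) ++ Y′     ≡⟨ ++-assoc xs₁ _ Y′ ⟩
      xs₁ ++ (xs₂ ++ E) ++ Y′     ≡⟨ cong (xs₁ ++_) (++-assoc xs₂ E Y′) ⟩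
      xs₁ ++ xs₂ ++ E ++ Y′       ≈⟨ SetEq.∙-cong same₁ (SetEq.∙-cong same₂
                                       (SetEq.∙-cong (SetEq.refl {x = E}) (SetEq.sym (deduplicate-∈⇔ _≟B_)))) ⟩
      X₁ ++ X₂ ++ E ++ Y          ∎
      where
      E = ⟨ a₁ , a₂ ⟩ ∷ []
      open import Relation.Binary.Reasoning.Setoid (SetEq.setoid {B n})

  construction-is-face : (W : Subset n) (X₁ X₂ : List (B n)) (a₁ a₂ : Fin n) (Y : List (B n)) →
    ConstrData W X₁ X₂ a₁ a₂ Y → IsFace (Construct X₁ X₂ a₁ a₂ Y)
  construction-is-face W X₁ X₂ a₁ a₂ Y (_ , _ , off₁ , face₁ , off₂ , face₂ , a₁∈W , a₂∉W , pairsY)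
    with face⇒irr face₁ | face⇒irr face₂
  ... | xs₁ , irr₁ , same₁ | xs₂ , irr₂ , same₂ = irr⇒face C.enumeration-irr (C.same-elements same₁ same₂)
    where
    module C = Construction W a₁∈W a₂∉W
      (anti-mono (Equivalence.to same₁) (All.map offDiag⇒arc off₁))
      (anti-mono (Equivalence.to same₂) (All.map offDiag⇒arc off₂))
      (All.map pairIn⇒arc pairsY) irr₁ irr₂

  module Decomposition {xs : List (B n)} {a b : Fin n}
    (irr : Irredundant [] xs) (new : ¬ Gen xs ⟨ a , b ⟩) (a≢b : a ≢ b)
    (offDiagonal : All (λ x → ¬ Idempotent x) xs) where

    W : Subset n
    W = subsetOf (reach? xs a)

    a∈W : a S.∈ W
    a∈W = ∈-subsetOf⁺ (reach? xs a) (inj₁ refl)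

    -- b is unreachable from a, as ⟨ a , b ⟩ is not generated by xs.
    b∉W : b S.∈ ∁ W
    b∉W = x∉p⇒x∈∁p λ b∈W → [ a≢b , new ∘ walk⇒gen ]′ (∈-subsetOf⁻ (reach? xs a) b∈W)

    arrow-closed : ∀ {u v} → Arrow xs u v → u S.∈ W → v S.∈ W
    arrow-closed e u∈W = ∈-subsetOf⁺ (reach? xs a) (inj₂ (∈-subsetOf⁻ (reach? xs a) u∈W ◂ [ e ]))

    block : ∀ {x} → x ∈ xs → Arc W W x ⊎ Arc (∁ W) (∁ W) x ⊎ Arc (∁ W) W x
    block x∈ with non-idempotent⇒off-diagonal (All.lookup offDiagonal x∈)
    ... | p , q , refl , _ with p ∈S? W | q ∈S? W
    ... | yes p∈W | yes q∈W = inj₁ (p∈W , q∈W)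
    ... | yes p∈W | no  q∉W = contradiction (arrow-closed x∈ p∈W) q∉W
    ... | no  p∉W | no  q∉W = inj₂ (inj₁ (x∉p⇒x∈∁p p∉W , x∉p⇒x∈∁p q∉W))
    ... | no  p∉W | yes q∈W = inj₂ (inj₂ (x∉p⇒x∈∁p p∉W , q∈W))

    X₁ X₂ Y : List (B n)
    X₁ = filter (arc? W W) xs
    X₂ = filter (arc? (∁ W) (∁ W)) xs
    Y  = filter (arc? (∁ W) W) xs

    inner-block : (V : Subset n) → All (OffDiagIn V) (filter (arc? V V) xs) × IsFace (filter (arc? V V) xs)
    inner-block V =
      All.zipWith (uncurry arc⇒offDiag) (filter⁺ (arc? V V) offDiagonal , all-filter (arc? V V) xs) ,
      irr⇒face (irr-filter (arc? V V) ⊆-refl irr) (SetEq.refl {x = filter (arc? V V) xs})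

    decomposition-data : ConstrData W X₁ X₂ a b Y
    decomposition-data =
      (a , a∈W) , (b , b∉W) ,
      proj₁ (inner-block W) , proj₂ (inner-block W) ,
      proj₁ (inner-block (∁ W)) , proj₂ (inner-block (∁ W)) ,
      a∈W , b∉W , All.map arc⇒pairIn (all-filter (arc? (∁ W) W) xs)

    same-elements : xs ∷ʳ ⟨ a , b ⟩ ∼[ set ] Construct X₁ X₂ a b Y
    same-elements = begin
      xs ++ E               ≈⟨ SetEq.∙-cong (filter-cover (arc? W W) (arc? (∁ W) (∁ W)) (arc? (∁ W) W) block)
                                            (SetEq.refl {x = E}) ⟩
      (X₁ ++ X₂ ++ Y) ++ E  ≡⟨ ++-assoc X₁ (X₂ ++ Y) E ⟩
      X₁ ++ (X₂ ++ Y) ++ E  ≡⟨ cong (X₁ ++_) (++-assoc X₂ Y E) ⟩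
      X₁ ++ X₂ ++ Y ++ E    ≈⟨ SetEq.∙-cong (SetEq.refl {x = X₁})
                                 (SetEq.∙-cong (SetEq.refl {x = X₂}) (SetEq.comm Y E)) ⟩
      X₁ ++ X₂ ++ E ++ Y    ∎
      where
      E = ⟨ a , b ⟩ ∷ []
      open import Relation.Binary.Reasoning.Setoid (SetEq.setoid {B n})

  decomposition : (X : List (B n)) → IsFace X → ∃[ x ] (x ∈ X) → All (λ x → ¬ Idempotent x) X →
    ∃[ W ] ∃[ X₁ ] ∃[ X₂ ] ∃[ a₁ ] ∃[ a₂ ] ∃[ Y ]
      (ConstrData W X₁ X₂ a₁ a₂ Y × (∀ x → (x ∈ X ⇔ x ∈ Construct X₁ X₂ a₁ a₂ Y)))
  decomposition X face (x , x∈X) noIdempotent with face⇒irr face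
  ... | enum , irr , same with initLast enum
  ... | [] = contradiction (Equivalence.from same x∈X) λ ()
  ... | xs ∷ʳ′ e
    with irr-++⁻ xs irr
       | non-idempotent⇒off-diagonal (All.lookup noIdempotent (Equivalence.to same (∈-++⁺ʳ xs (here refl))))
  ... | irrXs , (new ∷ []) | a , b , refl , a≢b =
    W , X₁ , X₂ , a , b , Y , decomposition-data , λ _ → SetEq.trans (SetEq.sym same) same-elements
    where open Decomposition irrXs new a≢b (anti-mono (Equivalence.to same ∘ ∈-++⁺ˡ) noIdempotent)

lemma5p14 : (n : ℕ) → 1 ≤ n →
    ((W : Subset n) (X₁ X₂ : List (B n)) (a₁ a₂ : Fin n) (Y : List (B n)) →
      ConstrData W X₁ X₂ a₁ a₂ Y → IsFace (Construct X₁ X₂ a₁ a₂ Y))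
    ×
    ((X : List (B n)) → IsFace X → (∃[ x ] (x ∈ X)) → All (λ x → ¬ Idempotent x) X →
      ∃[ W ] ∃[ X₁ ] ∃[ X₂ ] ∃[ a₁ ] ∃[ a₂ ] ∃[ Y ]
        (ConstrData W X₁ X₂ a₁ a₂ Y × (∀ x → (x ∈ X ⇔ x ∈ Construct X₁ X₂ a₁ a₂ Y))))
lemma5p14 n _ = construction-is-face , decomposition
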